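{- Let $\mathcal{T}$ be a test cover of $[n]$ containing every singleton $\{i\}$, $i\in[n]$, let $k$ be a positive integer, and let $\mathcal{F}$ be the output of Greedy-mini-test on $\mathcal{T}$ and $k$, where $|\mathcal{F}|<2k-2$. Let $C_1,\ldots,C_l$ be the classes induced by $\mathcal{F}$, and assume that for every $i$ and every $C_i$-test $S\in\mathcal{T}$ we have $|S\cap C_i|\le |C_i|/2$. Then for any $i$ and any two $C_i$-tests $S,S'\in\mathcal{T}$, either $L(S)\subseteq L(S')$, or $L(S')\subseteq L(S)$, or $L(S)\cap L(S')=\emptyset$.
   Context: $[n]=\{1,\ldots,n\}$ is the set of items; tests are subsets of $[n]$ and $\mathcal{T}$ is a collection of distinct tests. A test $T$ separates distinct items $i,j$ if $|\{i,j\}\cap T|=1$; a collection of tests is a test cover of $[n]$ if every pair of distinct items is separated by one of its tests. The classes induced by a collection $\mathcal{F}$ of tests are the equivalence classes of the relation "$i,j$ are not separated by any test of $\mathcal{F}$". For $C\subseteq[n]$, a test $S\in\mathcal{T}$ is a $C$-test if $C\setminus S\neq\emptyset$ and $C\cap S\neq\emptyset$; for a $C_i$-test $S$, its local portion is $L(S)=C_i\cap S$. Algorithm Greedy-mini-test($\mathcal{T}$, $k$): start with $\mathcal{F}=\emptyset$; repeatedly, as long as $|\mathcal{F}|<2k-2$ and one of the following moves is possible, perform one: (a) add two tests of $\mathcal{T}\setminus\mathcal{F}$ to $\mathcal{F}$ if this increases the number of classes induced by $\mathcal{F}$ by at least $3$; (b) add one test of $\mathcal{T}\setminus\mathcal{F}$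 if this increases the number of classes induced by $\mathcal{F}$ by at least $2$. Stop when $|\mathcal{F}|\ge 2k-2$ or no move is possible, and output $\mathcal{F}$. -}

module Defs where

open import Data.Nat using (ℕ; _+_; _*_; _∸_; _≤_; _<_)
open import Data.Bool using (Bool)
open import Data.Bool.Properties using () renaming (_≟_ to _≟ᵇ_)
open import Data.Fin using (Fin)
open import Data.Fin.Subset using (Subset; _∈_; _∉_; _∩_; ∣_∣)
open import Data.Vec using (lookup; tabulate)
open import Data.List using (List; []; _∷_; length; deduplicate; allFin)
open import Data.List.Relation.Unary.All using (All; all?)
open import Data.List.Relation.Unary.Any using (Any)
open import Data.Product using (Σ; _×_)
open import Data.Sum using (_⊎_)
open import Relation.Nullary using (¬_; Dec; does)
open import Relation.Binary.PropositionalEquality using (_≡_; _≢_)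

Test : ℕ → Set
Test n = Subset n

_∈ᴸ_ : ∀ {n} → Test n → List (Test n) → Set
S ∈ᴸ 𝒯 = Any (S ≡_) 𝒯

_∉ᴸ_ : ∀ {n} → Test n → List (Test n) → Set
S ∉ᴸ 𝒯 = ¬ (S ∈ᴸ 𝒯)

Separates : ∀ {n} → Test n → Fin n → Fin n → Set
Separates S i j = (i ∈ S × j ∉ S) ⊎ (i ∉ S × j ∈ S)

IsTestCover : ∀ {n} → List (Test n) → Set
IsTestCover {n} 𝒯 = (i j : Fin n) → i ≢ j → Any (λ S → Separates S i j) 𝒯

NotSep : ∀ {n} → List (Test n) → Fin n → Fin n → Set
NotSep ℱ i j = All (λ S → lookup S i ≡ lookup S j) ℱ

notSep? : ∀ {n} (ℱ : List (Test n)) (i j : Fin n) → Dec (NotSep ℱ i j)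
notSep? ℱ i j = all? (λ S → lookup S i ≟ᵇ lookup S j) ℱ

classOf : ∀ {n} → List (Test n) → Fin n → Subset n
classOf ℱ x = tabulate (λ j → does (notSep? ℱ x j))

numClasses : ∀ {n} → List (Test n) → ℕ
numClasses {n} ℱ = length (deduplicate (notSep? ℱ) (allFin n))

IsCTest : ∀ {n} → Subset n → Test n → Set
IsCTest C S = Σ _ (λ j → j ∈ C × j ∉ S) × Σ _ (λ j → j ∈ C × j ∈ S)

L : ∀ {n} → Subset n → Test n → Subset n
L C S = C ∩ S

MoveA : ∀ {n} → List (Test n) → List (Test n) → Set
MoveA 𝒯 ℱ = Σ _ λ S → Σ _ λ S′ →
  S ∈ᴸ 𝒯 × S′ ∈ᴸ 𝒯 × S ∉ᴸ ℱ × S′ ∉ᴸ ℱ × S ≢ S′ ×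
  numClasses ℱ + 3 ≤ numClasses (S ∷ S′ ∷ ℱ)

MoveB : ∀ {n} → List (Test n) → List (Test n) → Set
MoveB 𝒯 ℱ = Σ _ λ S → S ∈ᴸ 𝒯 × S ∉ᴸ ℱ × numClasses ℱ + 2 ≤ numClasses (S ∷ ℱ)

data Reachable {n} (𝒯 : List (Test n)) (k : ℕ) : List (Test n) → Set where
  start : Reachable 𝒯 k []
  stepA : ∀ {ℱ} S S′ → Reachable 𝒯 k ℱ → length ℱ < 2 * k ∸ 2 →
          S ∈ᴸ 𝒯 → S′ ∈ᴸ 𝒯 → S ∉ᴸ ℱ → S′ ∉ᴸ ℱ → S ≢ S′ →
          numClasses ℱ + 3 ≤ numClasses (S ∷ S′ ∷ ℱ) →
          Reachable 𝒯 k (S ∷ S′ ∷ ℱ)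
  stepB : ∀ {ℱ} S → Reachable 𝒯 k ℱ → length ℱ < 2 * k ∸ 2 →
          S ∈ᴸ 𝒯 → S ∉ᴸ ℱ →
          numClasses ℱ + 2 ≤ numClasses (S ∷ ℱ) →
          Reachable 𝒯 k (S ∷ ℱ)

-- ℱ is a possible output of Greedy-mini-test(𝒯, k): a reachable state at
-- which the algorithm stops (|ℱ| ≥ 2k-2 or no move is possible).
GreedyOutput : ∀ {n} → List (Test n) → ℕ → List (Test n) → Set
GreedyOutput 𝒯 k ℱ = Reachable 𝒯 k ℱ ×
  (2 * k ∸ 2 ≤ length ℱ ⊎ (¬ MoveA 𝒯 ℱ × ¬ MoveB 𝒯 ℱ))

-- If L(S) and L(S′) crossed, i.e. met without either containing the other, pick
-- a ∈ L(S) ∩ L(S′), b ∈ L(S) ∖ S′ and c ∈ L(S′) ∖ S. As S and S′ each meet at most half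
-- of C and overlap inside C, inclusion–exclusion gives some d ∈ C outside both. The items
-- a, b, c, d are pairwise separated by S or S′, so adding S and S′ to ℱ splits C into at
-- least four classes: the class count rises by at least 3. Since S and S′ separate items
-- of C they are not in ℱ, so move (a) was still available although |ℱ| < 2k − 2,
-- contradicting that Greedy-mini-test stopped at ℱ.
module Submission where

open import Defs
open import Level using (_⊔_)
open import Data.Nat using (ℕ; suc; _+_; _*_; _∸_; _≤_; _<_; z≤n; s≤s)
open import Data.Nat.Properties
open import Data.Bool using (true; false)
open import Data.Fin using (Fin)
import Data.Fin.Properties as Fin
open import Data.Fin.Subset
  using (Subset; inside; outside; ⁅_⁆; _⊆_; _∩_; _∪_; Empty; Nonempty; ∣_∣)
  renaming (_∈_ to _∈ˢ_; _∉_ to _∉ˢ_)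
open import Data.Fin.Subset.Properties
  using (_∈?_; _⊆?_; nonempty?; p⊆q⇒∣p∣≤∣q∣; ∣⁅x⁆∣≡1; x∈⁅y⁆⇒x≡y; x∈p∩q⁺; x∈p∩q⁻; x∈p∪q⁺)
open import Data.Vec using ([]; _∷_)
open import Data.Vec.Properties using ([]=⇒lookup; lookup⇒[]=; lookup∘tabulate)
open import Data.List using (List; []; _∷_; _++_; length; filter; deduplicate; allFin)
open import Data.List.Properties using (filter-all)
open import Data.List.Membership.Propositional using (_∈_)
open import Data.List.Membership.Propositional.Properties using (∈-allFin)
open import Data.List.Relation.Unary.All as All using (All; []; _∷_)
import Data.List.Relation.Unary.All.Properties as All
open import Data.List.Relation.Unary.Any as Any using (Any; here; there; any?)
open import Data.List.Relation.Unary.Any.Properties using (++⁺ˡ)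
open import Data.List.Relation.Unary.AllPairs as AllPairs using (AllPairs; []; _∷_)
import Data.List.Relation.Unary.AllPairs.Properties as AllPairs
open import Data.List.Relation.Unary.Unique.Propositional using (Unique)
open import Data.Product using (∃; _×_; _,_; uncurry)
open import Data.Sum using (_⊎_; inj₁; inj₂)
open import Data.Empty using (⊥-elim)
open import Function using (_∘_; id)
open import Relation.Nullary using (¬_; Dec; yes; no; does; ¬?; _×-dec_; contradiction)
open import Relation.Binary.Core using (Rel; _⇒_)
open import Relation.Binary.Definitions using (Decidable; Transitive)
open import Relation.Binary.Structures using (IsEquivalence)
open import Relation.Binary.PropositionalEquality using (_≡_; refl; sym; trans; cong; subst)
import Relation.Binary.PropositionalEquality as ≡

Met : ∀ {a ℓ} {A : Set a} → Rel A ℓ → List A → A → Set (a ⊔ ℓ)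
Met R seen y = Any (λ s → R s y) seen

module _ {a ℓ} {A : Set a} {R : Rel A ℓ} (R? : Decidable R) where

  met? : (seen : List A) (y : A) → Dec (Met R seen y)
  met? seen y = any? (λ s → R? s y) seen

  fresh : List A → A → ℕ
  fresh seen y with met? seen y
  ... | yes _ = 0
  ... | no _ = 1

  -- The number of R-classes met by xs but not by seen, counted at their first element in xs.
  newClasses : List A → List A → ℕ
  newClasses seen [] = 0
  newClasses seen (y ∷ ys) = fresh seen y + newClasses (y ∷ seen) ys

  private
    unmet? : (seen : List A) (y : A) → Dec (¬ Met R seen y)
    unmet? seen y = ¬? (met? seen y)

    filter-unmet-∷ : ∀ y seen zs →
      filter (unmet? seen) (filter (¬? ∘ R? y) zs) ≡ filter (unmet? (y ∷ seen)) zs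
    filter-unmet-∷ y seen [] = refl
    filter-unmet-∷ y seen (z ∷ zs) with does (R? y z)
    ... | true = filter-unmet-∷ y seen zs
    ... | false with does (met? seen z)
    ...   | true = filter-unmet-∷ y seen zs
    ...   | false = cong (z ∷_) (filter-unmet-∷ y seen zs)

    length-filter-unmet-deduplicate : ∀ seen ys →
      length (filter (unmet? seen) (deduplicate R? ys)) ≡ newClasses seen ys
    length-filter-unmet-deduplicate seen [] = refl
    length-filter-unmet-deduplicate seen (y ∷ ys) with met? seen y
    ... | yes _ = trans (cong length (filter-unmet-∷ y seen (deduplicate R? ys)))
                        (length-filter-unmet-deduplicate (y ∷ seen) ys)
    ... | no _ = cong suc (trans (cong length (filter-unmet-∷ y seen (deduplicate R? ys)))
                                 (length-filter-unmet-deduplicate (y ∷ seen) ys))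

  length-deduplicate≡newClasses : ∀ xs → length (deduplicate R? xs) ≡ newClasses [] xs
  length-deduplicate≡newClasses xs = begin
    length (deduplicate R? xs)
      ≡⟨ cong length (sym (filter-all (unmet? []) (All.universal (λ _ ()) (deduplicate R? xs)))) ⟩
    length (filter (unmet? []) (deduplicate R? xs))
      ≡⟨ length-filter-unmet-deduplicate [] xs ⟩
    newClasses [] xs
      ∎
    where open ≡.≡-Reasoning

  fresh-∷ : ∀ y seen z → fresh (y ∷ seen) z ≤ fresh seen z
  fresh-∷ y seen z with R? y z | met? seen z
  ... | yes _ | _ = z≤n
  ... | no _ | yes _ = z≤n
  ... | no _ | no _ = ≤-refl

  fresh-∷-≡0 : ∀ {y z} seen → R y z → fresh (y ∷ seen) z ≡ 0
  fresh-∷-≡0 {y} {z} seen Ryz with met? (y ∷ seen) z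
  ... | yes _ = refl
  ... | no ¬m = ⊥-elim (¬m (here Ryz))

  fresh-≡1 : ∀ {seen y} → ¬ Met R seen y → fresh seen y ≡ 1
  fresh-≡1 {seen} {y} ¬m with met? seen y
  ... | yes m = ⊥-elim (¬m m)
  ... | no _ = refl

  fresh-resp : Transitive R → ∀ seen {u v} → R u v → fresh seen v ≤ fresh seen u
  fresh-resp R-trans seen {u} {v} Ruv with met? seen u | met? seen v
  ... | _ | yes _ = z≤n
  ... | no _ | no _ = ≤-refl
  ... | yes m | no ¬m = ⊥-elim (¬m (Any.map (λ Rsu → R-trans Rsu Ruv) m))

module _ {a ℓ ℓ′} {A : Set a} {R : Rel A ℓ} {R′ : Rel A ℓ′}
         (R? : Decidable R) (R′? : Decidable R′)
         (R-isEquivalence : IsEquivalence R) (R′-isEquivalence : IsEquivalence R′)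
         (R′⇒R : R′ ⇒ R) where

  private
    module R = IsEquivalence R-isEquivalence
    module R′ = IsEquivalence R′-isEquivalence

    Distinct′ : A → A → Set ℓ′
    Distinct′ u v = ¬ R′ u v

  fresh-mono : ∀ seen y → fresh R? seen y ≤ fresh R′? seen y
  fresh-mono seen y with met? R? seen y | met? R′? seen y
  ... | yes _ | _ = z≤n
  ... | no _ | no _ = ≤-refl
  ... | no ¬m | yes m′ = ⊥-elim (¬m (Any.map R′⇒R m′))

  private
    drop-class : A → List A → List A
    drop-class y = filter (¬? ∘ R′? y)

    length-drop-class : ∀ y P → AllPairs Distinct′ P → Any (R′ y) P →
      length P ≡ suc (length (drop-class y P))
    length-drop-class y (w ∷ P) (w≁P ∷ P!) y∼P with R′? y w
    ... | yes y∼w = cong suc (cong length (sym (filter-all (¬? ∘ R′? y)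
                      (All.map (λ w≁v y∼v → w≁v (R′.trans (R′.sym y∼w) y∼v)) w≁P))))
    ... | no y≁w with y∼P
    ...   | here y∼w = ⊥-elim (y≁w y∼w)
    ...   | there y∼P′ = cong suc (length-drop-class y P P! y∼P′)

    drop-class-⊆ : ∀ {y ys} P → All (_∈ y ∷ ys) P → All (_∈ ys) (drop-class y P)
    drop-class-⊆ {y} P P⊆ = All.zipWith
      (λ { (here refl , y≁y) → ⊥-elim (y≁y R′.refl) ; (there w∈ys , _) → w∈ys })
      (All.filter⁺ (¬? ∘ R′? y) P⊆ , All.all-filter (¬? ∘ R′? y) P)

    drop-class-unmet : ∀ {y seen} P → All (¬_ ∘ Met R′ seen) P →
      All (¬_ ∘ Met R′ (y ∷ seen)) (drop-class y P)
    drop-class-unmet {y} P unmet = All.zipWith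
      (λ { (¬m , y≁w) (here y∼w) → y≁w y∼w ; (¬m , _) (there m) → ¬m m })
      (All.filter⁺ (¬? ∘ R′? y) unmet , All.all-filter (¬? ∘ R′? y) P)

  -- Each element of P opens its own R′-class, while the R-class of r containing all of P is
  -- counted at most once.
  newClasses-split : ∀ xs seen r P →
    All (_∈ xs) P → All (R r) P → AllPairs Distinct′ P → All (¬_ ∘ Met R′ seen) P →
    newClasses R? seen xs + length P ≤ newClasses R′? seen xs + fresh R? seen r
  newClasses-split [] seen r [] _ _ _ _ = z≤n
  newClasses-split [] seen r (_ ∷ _) (() ∷ _) _ _ _
  newClasses-split (y ∷ ys) seen r P P⊆ r∼P P! unmet = split (any? (R′? y) P)
    where
      open ≤-Reasoning
      f = fresh R? seen y
      f′ = fresh R′? seen y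
      N = newClasses R? (y ∷ seen) ys
      N′ = newClasses R′? (y ∷ seen) ys
      P′ = drop-class y P

      IH : N + length P′ ≤ N′ + fresh R? (y ∷ seen) r
      IH = newClasses-split ys (y ∷ seen) r P′ (drop-class-⊆ P P⊆)
             (All.filter⁺ (¬? ∘ R′? y) r∼P) (AllPairs.filter⁺ (¬? ∘ R′? y) P!)
             (drop-class-unmet P unmet)

      split : Dec (Any (R′ y) P) → f + N + length P ≤ f′ + N′ + fresh R? seen r
      split (yes y∼P) with All.lookupAny (All.zip (r∼P , unmet)) y∼P
      ... | (r∼w , w-unmet) , y∼w = begin
        f + N + length P                ≡⟨ cong (f + N +_) (length-drop-class y P P! y∼P) ⟩
        f + N + suc (length P′)         ≡⟨ trans (+-assoc f N _) (cong (f +_) (+-suc N _)) ⟩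
        f + suc (N + length P′)         ≤⟨ +-mono-≤ (fresh-resp R? R.trans seen r∼y) (s≤s IH) ⟩
        fresh R? seen r + suc (N′ + fresh R? (y ∷ seen) r)
                                        ≡⟨ cong (λ t → fresh R? seen r + suc (N′ + t))
                                                (fresh-∷-≡0 R? seen y∼r) ⟩
        fresh R? seen r + suc (N′ + 0)  ≡⟨ +-comm (fresh R? seen r) _ ⟩
        suc (N′ + 0) + fresh R? seen r  ≡⟨ cong (λ t → suc t + fresh R? seen r) (+-identityʳ N′) ⟩
        1 + N′ + fresh R? seen r        ≡⟨ cong (λ t → t + N′ + fresh R? seen r) (sym f′≡1) ⟩
        f′ + N′ + fresh R? seen r       ∎
        where
          y∼r : R y r
          y∼r = R.trans (R′⇒R y∼w) (R.sym r∼w)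
          r∼y : R r y
          r∼y = R.sym y∼r
          f′≡1 : f′ ≡ 1
          f′≡1 = fresh-≡1 R′? (w-unmet ∘ Any.map (λ s∼y → R′.trans s∼y y∼w))
      split (no y≁P) = begin
        f + N + length P                ≡⟨ cong (λ t → f + N + length t)
                                             (sym (filter-all (¬? ∘ R′? y) (All.¬Any⇒All¬ P y≁P))) ⟩
        f + N + length P′               ≡⟨ +-assoc f N _ ⟩
        f + (N + length P′)             ≤⟨ +-mono-≤ (fresh-mono seen y) IH ⟩
        f′ + (N′ + fresh R? (y ∷ seen) r)
                                        ≤⟨ +-monoʳ-≤ f′ (+-monoʳ-≤ N′ (fresh-∷ R? y seen r)) ⟩
        f′ + (N′ + fresh R? seen r)     ≡⟨ +-assoc f′ N′ _ ⟨
        f′ + N′ + fresh R? seen r       ∎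

  length-deduplicate-split : ∀ xs r P → All (_∈ xs) P → All (R r) P → AllPairs Distinct′ P →
    length (deduplicate R? xs) + length P ≤ length (deduplicate R′? xs) + 1
  length-deduplicate-split xs r P P⊆ r∼P P! = begin
    length (deduplicate R? xs) + length P   ≡⟨ cong (_+ length P) (length-deduplicate≡newClasses R? xs) ⟩
    newClasses R? [] xs + length P          ≤⟨ newClasses-split xs [] r P P⊆ r∼P P! (All.universal (λ _ ()) P) ⟩
    newClasses R′? [] xs + 1                ≡⟨ cong (_+ 1) (length-deduplicate≡newClasses R′? xs) ⟨
    length (deduplicate R′? xs) + 1         ∎
    where open ≤-Reasoning

∣p∪q∣+∣p∩q∣≡∣p∣+∣q∣ : ∀ {n} (p q : Subset n) → ∣ p ∪ q ∣ + ∣ p ∩ q ∣ ≡ ∣ p ∣ + ∣ q ∣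
∣p∪q∣+∣p∩q∣≡∣p∣+∣q∣ []            []            = refl
∣p∪q∣+∣p∩q∣≡∣p∣+∣q∣ (inside  ∷ p) (inside  ∷ q) =
  cong suc (trans (+-suc ∣ p ∪ q ∣ _) (trans (cong suc (∣p∪q∣+∣p∩q∣≡∣p∣+∣q∣ p q)) (sym (+-suc ∣ p ∣ _))))
∣p∪q∣+∣p∩q∣≡∣p∣+∣q∣ (inside  ∷ p) (outside ∷ q) = cong suc (∣p∪q∣+∣p∩q∣≡∣p∣+∣q∣ p q)
∣p∪q∣+∣p∩q∣≡∣p∣+∣q∣ (outside ∷ p) (inside  ∷ q) =
  trans (cong suc (∣p∪q∣+∣p∩q∣≡∣p∣+∣q∣ p q)) (sym (+-suc ∣ p ∣ _))
∣p∪q∣+∣p∩q∣≡∣p∣+∣q∣ (outside ∷ p) (outside ∷ q) = ∣p∪q∣+∣p∩q∣≡∣p∣+∣q∣ p q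

x∈p⇒0<∣p∣ : ∀ {n} {p : Subset n} {x} → x ∈ˢ p → 0 < ∣ p ∣
x∈p⇒0<∣p∣ {p = p} {x} x∈p = subst (_≤ ∣ p ∣) (∣⁅x⁆∣≡1 x)
  (p⊆q⇒∣p∣≤∣q∣ λ y∈⁅x⁆ → subst (_∈ˢ p) (sym (x∈⁅y⁆⇒x≡y x y∈⁅x⁆)) x∈p)

⊈⇒∃∈∉ : ∀ {n} {p q : Subset n} → ¬ p ⊆ q → ∃ λ x → x ∈ˢ p × x ∉ˢ q
⊈⇒∃∈∉ {p = p} {q} p⊈q with Fin.any? (λ x → x ∈? p ×-dec ¬? (x ∈? q))
... | yes witness = witness
... | no ∄ = contradiction (λ {x} → p⊆q {x}) p⊈q
  where
    p⊆q : p ⊆ q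
    p⊆q {x} x∈p with x ∈? q
    ... | yes x∈q = x∈q
    ... | no x∉q = contradiction (x , x∈p , x∉q) ∄

sum-of-halves≤ : ∀ {m m′ k} → 2 * m ≤ k → 2 * m′ ≤ k → m + m′ ≤ k
sum-of-halves≤ {m} {m′} {k} half half′ = *-cancelˡ-≤ 2 (begin
  2 * (m + m′)      ≡⟨ *-distribˡ-+ 2 m m′ ⟩
  2 * m + 2 * m′    ≤⟨ +-mono-≤ half half′ ⟩
  k + k             ≡⟨ cong (k +_) (+-identityʳ k) ⟨
  2 * k             ∎)
  where open ≤-Reasoning

∃-outside-sum-of-halves≤ : ∀ {n} {C S S′ : Subset n} {a} →
  2 * ∣ S ∩ C ∣ ≤ ∣ C ∣ → 2 * ∣ S′ ∩ C ∣ ≤ ∣ C ∣ → a ∈ˢ C → a ∈ˢ S → a ∈ˢ S′ →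
  ∃ λ d → d ∈ˢ C × d ∉ˢ S × d ∉ˢ S′
∃-outside-sum-of-halves≤ {C = C} {S} {S′} {a} half half′ a∈C a∈S a∈S′
  with Fin.any? (λ d → d ∈? C ×-dec ¬? (d ∈? S) ×-dec ¬? (d ∈? S′))
... | yes witness = witness
... | no ∄ = contradiction (sum-of-halves≤ {∣ p ∣} {∣ q ∣} half half′) (<⇒≱ ∣C∣<∣p∣+∣q∣)
  where
    p = S ∩ C
    q = S′ ∩ C
    C⊆p∪q : C ⊆ p ∪ q
    C⊆p∪q {d} d∈C with d ∈? S | d ∈? S′
    ... | yes d∈S | _ = x∈p∪q⁺ (inj₁ (x∈p∩q⁺ (d∈S , d∈C)))
    ... | no _ | yes d∈S′ = x∈p∪q⁺ (inj₂ (x∈p∩q⁺ (d∈S′ , d∈C)))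
    ... | no d∉S | no d∉S′ = contradiction (d , d∈C , d∉S , d∉S′) ∄
    a∈p∩q : a ∈ˢ p ∩ q
    a∈p∩q = x∈p∩q⁺ (x∈p∩q⁺ (a∈S , a∈C) , x∈p∩q⁺ (a∈S′ , a∈C))
    ∣C∣<∣p∣+∣q∣ : ∣ C ∣ < ∣ p ∣ + ∣ q ∣
    ∣C∣<∣p∣+∣q∣ = begin-strict
      ∣ C ∣                    ≡⟨ +-identityʳ ∣ C ∣ ⟨
      ∣ C ∣ + 0                <⟨ +-mono-≤-< (p⊆q⇒∣p∣≤∣q∣ C⊆p∪q) (x∈p⇒0<∣p∣ a∈p∩q) ⟩
      ∣ p ∪ q ∣ + ∣ p ∩ q ∣    ≡⟨ ∣p∪q∣+∣p∩q∣≡∣p∣+∣q∣ p q ⟩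
      ∣ p ∣ + ∣ q ∣            ∎
      where open ≤-Reasoning

private
  variable
    n : ℕ

NotSep-isEquivalence : (ℱ : List (Test n)) → IsEquivalence (NotSep ℱ)
NotSep-isEquivalence ℱ = record
  { refl  = All.universal (λ _ → refl) ℱ
  ; sym   = All.map sym
  ; trans = λ p q → All.zipWith (uncurry trans) (p , q)
  }

SeparatedBy : List (Test n) → Fin n → Fin n → Set
SeparatedBy ℱ i j = Any (λ S → Separates S i j) ℱ

separatedBy⇒¬NotSep : ∀ {ℱ : List (Test n)} {i j} → SeparatedBy ℱ i j → ¬ NotSep ℱ i j
separatedBy⇒¬NotSep (here (inj₁ (i∈S , j∉S))) (Si≡Sj ∷ _) =
  j∉S (lookup⇒[]= _ _ (trans (sym Si≡Sj) ([]=⇒lookup i∈S)))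
separatedBy⇒¬NotSep (here (inj₂ (i∉S , j∈S))) (Si≡Sj ∷ _) =
  i∉S (lookup⇒[]= _ _ (trans Si≡Sj ([]=⇒lookup j∈S)))
separatedBy⇒¬NotSep (there sep) (_ ∷ ns) = separatedBy⇒¬NotSep sep ns

∈-classOf⇒NotSep : (ℱ : List (Test n)) (x : Fin n) {j : Fin n} → j ∈ˢ classOf ℱ x → NotSep ℱ x j
∈-classOf⇒NotSep ℱ x {j} j∈C
  with notSep? ℱ x j | trans (sym (lookup∘tabulate _ j)) ([]=⇒lookup j∈C)
... | yes ns | _  = ns
... | no _   | ()

numClasses-split : (ℱ 𝒢 : List (Test n)) (x : Fin n) (P : List (Fin n)) →
  All (_∈ˢ classOf ℱ x) P → AllPairs (SeparatedBy 𝒢) P →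
  numClasses ℱ + length P ≤ numClasses (𝒢 ++ ℱ) + 1
numClasses-split {n} ℱ 𝒢 x P P⊆C P! =
  length-deduplicate-split (notSep? ℱ) (notSep? (𝒢 ++ ℱ))
    (NotSep-isEquivalence ℱ) (NotSep-isEquivalence (𝒢 ++ ℱ)) (All.++⁻ʳ 𝒢)
    (allFin n) x P (All.universal ∈-allFin P) (All.map (∈-classOf⇒NotSep ℱ x) P⊆C)
    (AllPairs.map (separatedBy⇒¬NotSep ∘ ++⁺ˡ) P!)

CTest⇒∉ᴸ : (ℱ : List (Test n)) (x : Fin n) {T : Test n} → IsCTest (classOf ℱ x) T → T ∉ᴸ ℱ
CTest⇒∉ᴸ ℱ x {T} ((i , i∈C , i∉T) , (j , j∈C , j∈T)) T∈ℱ =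
  separatedBy⇒¬NotSep (Any.map (λ { refl → inj₁ (j∈T , i∉T) }) T∈ℱ)
    (NotSep.trans (NotSep.sym (∈-classOf⇒NotSep ℱ x j∈C)) (∈-classOf⇒NotSep ℱ x i∈C))
  where module NotSep = IsEquivalence (NotSep-isEquivalence ℱ)

module _ (ℱ : List (Test n)) (x : Fin n) {S S′ : Test n} where

  private
    C = classOf ℱ x

  crossing⇒numClasses+3 : 2 * ∣ S ∩ C ∣ ≤ ∣ C ∣ → 2 * ∣ S′ ∩ C ∣ ≤ ∣ C ∣ →
    ¬ L C S ⊆ L C S′ → ¬ L C S′ ⊆ L C S → Nonempty (L C S ∩ L C S′) →
    numClasses ℱ + 3 ≤ numClasses (S ∷ S′ ∷ ℱ)
  crossing⇒numClasses+3 half half′ S⊈S′ S′⊈S (a , a∈LS∩LS′)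
    with x∈p∩q⁻ (L C S) (L C S′) a∈LS∩LS′ | ⊈⇒∃∈∉ S⊈S′ | ⊈⇒∃∈∉ S′⊈S
  ... | a∈LS , a∈LS′ | b , b∈LS , b∉LS′ | c , c∈LS′ , c∉LS
    with x∈p∩q⁻ C S a∈LS | x∈p∩q⁻ C S′ a∈LS′ | x∈p∩q⁻ C S b∈LS | x∈p∩q⁻ C S′ c∈LS′
  ... | a∈C , a∈S | _ , a∈S′ | b∈C , b∈S | c∈C , c∈S′
    with ∃-outside-sum-of-halves≤ half half′ a∈C a∈S a∈S′
  ... | d , d∈C , d∉S , d∉S′ = +-cancelʳ-≤ 1 _ _
    (subst (_≤ numClasses (S ∷ S′ ∷ ℱ) + 1) (sym (+-assoc (numClasses ℱ) 3 1)) (numClasses-split ℱ (S ∷ S′ ∷ []) x (a ∷ b ∷ c ∷ d ∷ [])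
      (a∈C ∷ b∈C ∷ c∈C ∷ d∈C ∷ [])
      ((by-S′ a∈S′ b∉S′ ∷ by-S a∈S c∉S ∷ by-S a∈S d∉S ∷ []) ∷
       (by-S b∈S c∉S ∷ by-S b∈S d∉S ∷ []) ∷
       (by-S′ c∈S′ d∉S′ ∷ []) ∷
       [] ∷ [])))
    where
      b∉S′ : b ∉ˢ S′
      b∉S′ b∈S′ = b∉LS′ (x∈p∩q⁺ (b∈C , b∈S′))
      c∉S : c ∉ˢ S
      c∉S c∈S = c∉LS (x∈p∩q⁺ (c∈C , c∈S))
      by-S : ∀ {i j} → i ∈ˢ S → j ∉ˢ S → SeparatedBy (S ∷ S′ ∷ []) i j
      by-S i∈S j∉S = here (inj₁ (i∈S , j∉S))
      by-S′ : ∀ {i j} → i ∈ˢ S′ → j ∉ˢ S′ → SeparatedBy (S ∷ S′ ∷ []) i j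
      by-S′ i∈S′ j∉S′ = there (here (inj₁ (i∈S′ , j∉S′)))

greedyOutput⇒¬MoveA : ∀ {𝒯 : List (Test n)} {k ℱ} →
  GreedyOutput 𝒯 k ℱ → length ℱ < 2 * k ∸ 2 → ¬ MoveA 𝒯 ℱ
greedyOutput⇒¬MoveA (_ , inj₁ long)      short = contradiction long (<⇒≱ short)
greedyOutput⇒¬MoveA (_ , inj₂ (¬A , _)) _     = ¬A

lemma5 : (n : ℕ) (𝒯 : List (Test n)) → Unique 𝒯 → IsTestCover 𝒯 →
    ((i : Fin n) → ⁅ i ⁆ ∈ᴸ 𝒯) →
    (k : ℕ) → 1 ≤ k →
    (ℱ : List (Test n)) → GreedyOutput 𝒯 k ℱ → length ℱ < 2 * k ∸ 2 →
    ((x : Fin n) (S : Test n) → S ∈ᴸ 𝒯 → IsCTest (classOf ℱ x) S →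
      2 * ∣ S ∩ classOf ℱ x ∣ ≤ ∣ classOf ℱ x ∣) →
    (x : Fin n) (S S′ : Test n) → S ∈ᴸ 𝒯 → S′ ∈ᴸ 𝒯 →
    IsCTest (classOf ℱ x) S → IsCTest (classOf ℱ x) S′ →
    (L (classOf ℱ x) S ⊆ L (classOf ℱ x) S′) ⊎
    (L (classOf ℱ x) S′ ⊆ L (classOf ℱ x) S) ⊎
    Empty (L (classOf ℱ x) S ∩ L (classOf ℱ x) S′)
lemma5 n 𝒯 _ _ _ k _ ℱ output short half x S S′ S∈𝒯 S′∈𝒯 S-test S′-test
  with L (classOf ℱ x) S ⊆? L (classOf ℱ x) S′ | L (classOf ℱ x) S′ ⊆? L (classOf ℱ x) S
     | nonempty? (L (classOf ℱ x) S ∩ L (classOf ℱ x) S′)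
... | yes S⊆S′ | _         | _            = inj₁ S⊆S′
... | no _     | yes S′⊆S  | _            = inj₂ (inj₁ S′⊆S)
... | no _     | no _      | no disjoint  = inj₂ (inj₂ disjoint)
... | no S⊈S′  | no S′⊈S   | yes meet     = contradiction
  (S , S′ , S∈𝒯 , S′∈𝒯 , CTest⇒∉ᴸ ℱ x S-test , CTest⇒∉ᴸ ℱ x S′-test , (λ { refl → S⊈S′ id }) ,
   crossing⇒numClasses+3 ℱ x (half x S S∈𝒯 S-test) (half x S′ S′∈𝒯 S′-test) S⊈S′ S′⊈S meet)
  (greedyOutput⇒¬MoveA output short)
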